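{- Let $S$ be a string of length $n$ in which every character occurs at least twice, let $\sigma$ be a character of $S$ occurring $\ell\ge 2$ times, at positions $i_1<\dots<i_\ell$, and let $e=\lfloor \ell/2\rfloor$. Let $Y$ be any maximal common subsequence of $S[i_1,i_{e+1})$ and $S[i_{e+1},n]$ containing $\sigma^e$; if $\ell$ is odd and $Y$ is a subsequence of $S[i_{e+2},n]$, replace $Y$ by any maximal common subsequence of $S[i_1,i_{e+2})$ and $S[i_{e+2},n]$ containing the old $Y$. Let $X_1=YY$. Then every square subsequence of $S$ that contains $X_1$ as a subsequence is not right-extendable.
   Context: For a string $S$, $S[i,j]=S[i]\cdots S[j]$ (empty if $j<i$), $S[i,j)=S[i,j-1]$, $S(i,j]=S[i+1,j]$; $\sigma^e$ is $e$ copies of $\sigma$. A common subsequence $C$ of $S_1,S_2$ is maximal if no common subsequence of $S_1,S_2$ properly contains it. A square subsequence of $S$ is a subsequence of $S$ of the form $WW$. A square subsequence $WW$ is right-extendable if there is a character $y$ such that $WyWy$ is a subsequence of $S$. -}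

module Defs where

open import Data.Nat using (ℕ; zero; suc; _<_; _%_)
open import Data.List using (List; []; _∷_; _++_; [_]; take; drop; replicate)
open import Data.Maybe using (Maybe; just; nothing)
open import Data.Product using (_×_; ∃-syntax)
open import Data.Sum using (_⊎_)
open import Relation.Binary.PropositionalEquality using (_≡_)
open import Relation.Nullary using (¬_)
import Data.List.Relation.Binary.Sublist.Propositional as Sub

_⊑_ : {A : Set} → List A → List A → Set
_⊑_ {A} xs ys = Sub._⊆_ {A = A} xs ys

infix 4 _⊑_

_!_ : {A : Set} → List A → ℕ → Maybe A
[] ! _ = nothing
(x ∷ xs) ! zero = just x
(x ∷ xs) ! suc j = xs ! j

-- slice S a b = 0-indexed substring S[a .. b-1]
slice : {A : Set} → List A → ℕ → ℕ → List A
slice S a b = drop a (take b S)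

CommonSubseq : {A : Set} → List A → List A → List A → Set
CommonSubseq C S₁ S₂ = C ⊑ S₁ × C ⊑ S₂

MaximalCS : {A : Set} → List A → List A → List A → Set
MaximalCS C S₁ S₂ =
  CommonSubseq C S₁ S₂ × (∀ D → CommonSubseq D S₁ S₂ → C ⊑ D → D ≡ C)

SquareSubseq : {A : Set} → List A → List A → Set
SquareSubseq W S = (W ++ W) ⊑ S

RightExtendable : {A : Set} → List A → List A → Set
RightExtendable W S = ∃[ y ] ((W ++ [ y ]) ++ (W ++ [ y ])) ⊑ S

EveryCharTwice : {A : Set} → List A → Set
EveryCharTwice S = ∀ j x → S ! j ≡ just x → ∃[ j' ] (¬ (j' ≡ j) × S ! j' ≡ just x)

-- p 0 < p 1 < ... < p (ℓ-1) are exactly the (0-indexed) positions of σ in S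
OccurrencePositions : {A : Set} → List A → A → ℕ → (ℕ → ℕ) → Set
OccurrencePositions S σ ℓ p =
  (∀ k → suc k < ℓ → p k < p (suc k)) ×
  (∀ k → k < ℓ → S ! p k ≡ just σ) ×
  (∀ j → S ! j ≡ just σ → ∃[ k ] (k < ℓ × p k ≡ j))

-- The (possibly replaced) Y of the statement, with e = ⌊ℓ/2⌋ and Y₀ the initial choice:
-- if ℓ is odd and Y₀ ⊑ S[i_{e+2}, n], Y is a maximal common subsequence of
-- S[i_1, i_{e+2}) and S[i_{e+2}, n] containing Y₀; otherwise Y = Y₀.
FinalY : {A : Set} → List A → ℕ → (ℕ → ℕ) → ℕ → List A → List A → Set
FinalY S ℓ p e Y₀ Y =
  ((ℓ % 2 ≡ 1 × Y₀ ⊑ drop (p (suc e)) S) ×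
     (MaximalCS Y (slice S (p 0) (p (suc e))) (drop (p (suc e)) S) × Y₀ ⊑ Y))
  ⊎ (¬ (ℓ % 2 ≡ 1 × Y₀ ⊑ drop (p (suc e)) S) × Y ≡ Y₀)

{-# OPTIONS --safe #-}
-- Y begins with σ: it lies in S[i₁, i_{e+1}) (resp. in S[i_{e+2}, n] after a replacement) and
-- contains σᵉ, which does not fit after the first σ of that window. So if WW ⊒ YY then W = BσR
-- with Y ⊑ σR, and if moreover WyWy ⊑ S, the second copy of D = σRy starts at some occurrence
-- i_{k+1} = p k while the first lies after i₁: D is a common subsequence of S[i₁, i_{k+1}) and
-- S[i_{k+1}, n]. Counting the e copies of σ in D on both sides leaves k = e, or ℓ odd and
-- k = e + 1. Since D properly extends σR ⊒ Y ⊒ Y₀, the first case contradicts the maximality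
-- of Y₀; in the second, D either contradicts the maximality of the replaced Y or shows that
-- Y ⊑ S[i_{e+2}, n], so that Y should have been replaced.
module Submission where

open import Defs
open import Data.Nat using (ℕ; zero; suc; _+_; _≤_; _<_; z≤n; s≤s; ⌊_/2⌋; _%_)
open import Data.Nat.Properties
open import Data.List using (List; []; _∷_; _++_; [_]; drop; take; replicate; length)
open import Data.List.Properties using (take-all; ++-assoc; length-++)
open import Data.Maybe using (just)
open import Data.Product using (_×_; _,_; ∃-syntax; proj₁; proj₂)
open import Data.Sum using (_⊎_; inj₁; inj₂; [_,_]′)
open import Data.Empty using (⊥-elim)
open import Function using (id; _∘_; case_of_)
open import Relation.Binary.PropositionalEquality using (_≡_; refl; sym; trans; cong; subst)
open import Relation.Nullary using (¬_)
open import Data.List.Relation.Binary.Sublist.Propositional using ([]; _∷_; _∷ʳ_; ⊆-refl; ⊆-trans)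
open import Data.List.Relation.Binary.Sublist.Propositional.Properties
  using ([]⊆-universal; ++⁺ˡ; ++⁺ʳ; drop⁺-≥; length-mono-≤)

private variable
  A : Set
  x y : A
  V W X Z : List A
  a b q : ℕ

++⊑++⇒⊑⊎⊑ : (X W : List A) → X ++ V ⊑ W ++ Z → X ⊑ W ⊎ V ⊑ Z
++⊑++⇒⊑⊎⊑ X []      s              = inj₂ (⊆-trans (++⁺ˡ X ⊆-refl) s)
++⊑++⇒⊑⊎⊑ []      (w ∷ W) _        = inj₁ ([]⊆-universal _)
++⊑++⇒⊑⊎⊑ (x ∷ X) (w ∷ W) (.w ∷ʳ s) with ++⊑++⇒⊑⊎⊑ (x ∷ X) W s
... | inj₁ t = inj₁ (w ∷ʳ t)
... | inj₂ t = inj₂ t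
++⊑++⇒⊑⊎⊑ (x ∷ X) (w ∷ W) (x≡w ∷ s) with ++⊑++⇒⊑⊎⊑ X W s
... | inj₁ t = inj₁ (x≡w ∷ t)
... | inj₂ t = inj₂ t

square⊑square⇒⊑ : X ++ X ⊑ W ++ W → X ⊑ W
square⊑square⇒⊑ {X = X} {W = W} s = [ id , id ]′ (++⊑++⇒⊑⊎⊑ X W s)

∷⊑⇒++∷ : x ∷ X ⊑ W → ∃[ B ] ∃[ R ] (W ≡ B ++ x ∷ R × X ⊑ R)
∷⊑⇒++∷ (w ∷ʳ s) with ∷⊑⇒++∷ s
... | B , R , refl , X⊑R = w ∷ B , R , refl , X⊑R
∷⊑⇒++∷ (refl ∷ s) = [] , _ , refl , s

maximal⇒¬commonSubseq-∷ʳ : {C S₁ S₂ : List A} → MaximalCS C S₁ S₂ → C ⊑ Z →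
  ¬ CommonSubseq (Z ++ [ y ]) S₁ S₂
maximal⇒¬commonSubseq-∷ʳ {Z = Z} {y = y} {C = C} (_ , maximal) C⊑Z common =
  <⇒≱ Z<Zy (length-mono-≤ (subst (_⊑ Z) (sym Zy≡C) C⊑Z))
  where
  Zy≡C : Z ++ [ y ] ≡ C
  Zy≡C = maximal (Z ++ [ y ]) common (⊆-trans C⊑Z (++⁺ʳ [ y ] ⊆-refl))
  Z<Zy : length Z < length (Z ++ [ y ])
  Z<Zy = subst (length Z <_) (sym (length-++ Z)) (m<m+n (length Z) (s≤s z≤n))

take-! : ∀ {b} (T : List A) q → q < b → take b T ! q ≡ T ! q
take-! {b = suc b} []      _       _         = refl
take-! {b = suc b} (t ∷ T) zero    _         = refl
take-! {b = suc b} (t ∷ T) (suc q) (s≤s q<b) = take-! T q q<b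

take-!-< : ∀ {b} (T : List A) q → take b T ! q ≡ just x → q < b
take-!-< {b = suc b} (t ∷ T) zero    _    = s≤s z≤n
take-!-< {b = suc b} (t ∷ T) (suc q) look = s≤s (take-!-< T q look)
take-!-< {b = zero}  _       _       ()
take-!-< {b = suc b} []      _       ()

!⇒∷⊑drop : (T : List A) (q : ℕ) → T ! q ≡ just x → V ⊑ drop (suc q) T → x ∷ V ⊑ drop q T
!⇒∷⊑drop (t ∷ T) zero    refl s = refl ∷ s
!⇒∷⊑drop (t ∷ T) (suc q) look s = !⇒∷⊑drop T q look s
!⇒∷⊑drop []      _       ()   _

⊑drop⇒head : (T : List A) (a : ℕ) → T ! a ≡ just x → X ⊑ drop a T → ¬ X ⊑ drop (suc a) T →
  ∃[ X' ] X ≡ x ∷ X'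
⊑drop⇒head (t ∷ T) zero    refl (.t ∷ʳ s)  X⋢ = ⊥-elim (X⋢ s)
⊑drop⇒head (t ∷ T) zero    refl (refl ∷ _) _  = _ , refl
⊑drop⇒head (t ∷ T) (suc a) look s          X⋢ = ⊑drop⇒head T a look s X⋢
⊑drop⇒head []      _       ()

⊑drop-pivot : (a : ℕ) (T U : List A) → U ++ x ∷ V ⊑ drop a T →
  ∃[ q ] (a ≤ q × T ! q ≡ just x × U ⊑ slice T a q × V ⊑ drop (suc q) T)
⊑drop-pivot (suc a) (t ∷ T) U s with ⊑drop-pivot a T U s
... | q , a≤q , look , U⊑ , V⊑ = suc q , s≤s a≤q , look , U⊑ , V⊑
⊑drop-pivot zero (t ∷ T) [] (.t ∷ʳ s) with ⊑drop-pivot zero T [] s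
... | q , _ , look , U⊑ , V⊑ = suc q , z≤n , look , t ∷ʳ U⊑ , V⊑
⊑drop-pivot zero (t ∷ T) [] (refl ∷ s) = zero , z≤n , refl , [] , s
⊑drop-pivot zero (t ∷ T) (u ∷ U) (.t ∷ʳ s) with ⊑drop-pivot zero T (u ∷ U) s
... | q , _ , look , U⊑ , V⊑ = suc q , z≤n , look , t ∷ʳ U⊑ , V⊑
⊑drop-pivot zero (t ∷ T) (u ∷ U) (refl ∷ s) with ⊑drop-pivot zero T U s
... | q , _ , look , U⊑ , V⊑ = suc q , z≤n , look , refl ∷ U⊑ , V⊑
⊑drop-pivot zero    [] []      ()
⊑drop-pivot zero    [] (_ ∷ _) ()
⊑drop-pivot (suc a) [] []      ()
⊑drop-pivot (suc a) [] (_ ∷ _) ()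

-- The parity is recorded through _%_ because that is how FinalY states it.
data Halving (e : ℕ) : ℕ → Set where
  even : ∀ {ℓ} → ℓ ≡ e + e → ℓ % 2 ≡ 0 → Halving e ℓ
  odd  : ∀ {ℓ} → ℓ ≡ suc (e + e) → ℓ % 2 ≡ 1 → Halving e ℓ

halving-2+ : ∀ {e ℓ} → Halving e ℓ → Halving (suc e) (suc (suc ℓ))
halving-2+ {e} (even refl ℓ%2≡0) = even (cong suc (sym (+-suc e e))) ℓ%2≡0
halving-2+ {e} (odd refl ℓ%2≡1)  = odd (cong (suc ∘ suc) (sym (+-suc e e))) ℓ%2≡1

⌊n/2⌋-halving : ∀ n → Halving ⌊ n /2⌋ n
⌊n/2⌋-halving 0             = even refl refl
⌊n/2⌋-halving 1             = odd refl refl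
⌊n/2⌋-halving (suc (suc n)) = halving-2+ (⌊n/2⌋-halving n)

halving-< : ∀ {e ℓ} → 1 ≤ e → Halving e ℓ → e < ℓ
halving-< {e} 1≤e (even refl _) = m<m+n e 1≤e
halving-< {e} _   (odd refl _)  = s≤s (m≤m+n e e)

halving-odd : ∀ {e ℓ} → Halving e ℓ → ℓ % 2 ≡ 1 → ℓ ≡ suc (e + e)
halving-odd (even _ ℓ%2≡0) ℓ%2≡1 = ⊥-elim (0≢1+n (trans (sym ℓ%2≡0) ℓ%2≡1))
halving-odd (odd ℓ≡ _)     _     = ℓ≡

halving-window : ∀ {e ℓ k} → Halving e ℓ → e ≤ k → k + e ≤ ℓ →
  k ≡ e ⊎ (ℓ % 2 ≡ 1 × k ≡ suc e)
halving-window half e≤k k+e≤ℓ with m≤n⇒m<n∨m≡n e≤k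
... | inj₂ refl = inj₁ refl
halving-window {e} (even refl _) _ k+e≤ℓ | inj₁ e<k = ⊥-elim (<⇒≱ (+-monoˡ-< e e<k) k+e≤ℓ)
halving-window {e} {k = k} (odd refl ℓ%2≡1) _ k+e≤ℓ | inj₁ e<k =
  inj₂ (ℓ%2≡1 , ≤-antisym (+-cancelʳ-≤ e k (suc e) k+e≤ℓ) e<k)

module Occurrences {A : Set} (S : List A) (σ : A) (ℓ : ℕ) (p : ℕ → ℕ)
                   (O : OccurrencePositions S σ ℓ p) where

  private
    p-suc : ∀ k → suc k < ℓ → p k < p (suc k)
    p-suc = proj₁ O

  p-σ : ∀ {k} → k < ℓ → S ! p k ≡ just σ
  p-σ = proj₁ (proj₂ O) _

  σ-index : S ! q ≡ just σ → ∃[ k ] (k < ℓ × p k ≡ q)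
  σ-index = proj₂ (proj₂ O) _

  p-mono-≤ : ∀ {i j} → i ≤ j → j < ℓ → p i ≤ p j
  p-mono-≤ {j = zero}  z≤n _ = ≤-refl
  p-mono-≤ {j = suc j} i≤j+1 j+1<ℓ with m≤n⇒m<n∨m≡n i≤j+1
  ... | inj₂ refl       = ≤-refl
  ... | inj₁ (s≤s i≤j) = ≤-trans (p-mono-≤ i≤j (<-trans (n<1+n j) j+1<ℓ)) (<⇒≤ (p-suc j j+1<ℓ))

  p-mono-< : ∀ {i j} → i < j → j < ℓ → p i < p j
  p-mono-< {j = suc j} (s≤s i≤j) j+1<ℓ =
    ≤-<-trans (p-mono-≤ i≤j (<-trans (n<1+n j) j+1<ℓ)) (p-suc j j+1<ℓ)

  p-cancel-< : ∀ {i j} → i < ℓ → p i < p j → i < j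
  p-cancel-< i<ℓ pi<pj = ≰⇒> (λ j≤i → <⇒≱ pi<pj (p-mono-≤ j≤i i<ℓ))

  p-cancel-≤ : ∀ {i j} → i < ℓ → p i ≤ p j → i ≤ j
  p-cancel-≤ i<ℓ pi≤pj = ≮⇒≥ (λ j<i → <⇒≱ (p-mono-< j<i i<ℓ) pi≤pj)

  IndexFrom : ℕ → ℕ → Set
  IndexFrom a i = ∀ k → k < ℓ → a ≤ p k → i ≤ k

  IndexBelow : ℕ → ℕ → Set
  IndexBelow b j = ∀ k → k < ℓ → p k < b → k < j

  indexFrom-p : ∀ {i} → i < ℓ → IndexFrom (p i) i
  indexFrom-p i<ℓ _ _ = p-cancel-≤ i<ℓ

  indexFrom-suc-p : ∀ {i} → i < ℓ → IndexFrom (suc (p i)) (suc i)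
  indexFrom-suc-p i<ℓ _ _ = p-cancel-< i<ℓ

  indexBelow-p : ∀ {j} → j < ℓ → IndexBelow (p j) j
  indexBelow-p _ _ k<ℓ = p-cancel-< k<ℓ

  replicate⊑slice⇒≤ : ∀ {c i j} → IndexFrom a i → IndexBelow b j → i ≤ j →
    replicate c σ ⊑ slice S a b → i + c ≤ j
  replicate⊑slice⇒≤ {c = zero} {i} {j} _ _ i≤j _ = subst (_≤ j) (sym (+-identityʳ i)) i≤j
  replicate⊑slice⇒≤ {a} {b} {suc c} {i} {j} from below _ s
    with ⊑drop-pivot a (take b S) [] s
  ... | q , a≤q , look , _ , rest with take-!-< {b = b} S q look
  ... | q<b with σ-index (trans (sym (take-! S q q<b)) look)
  ... | k , k<ℓ , refl = begin
    i + suc c   ≡⟨ +-suc i c ⟩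
    suc i + c   ≤⟨ +-monoˡ-≤ c (s≤s (from k k<ℓ a≤q)) ⟩
    suc k + c   ≤⟨ replicate⊑slice⇒≤ (indexFrom-suc-p k<ℓ) below (below k k<ℓ q<b) rest ⟩
    j           ∎
    where open ≤-Reasoning

  replicate⊑drop⇒≤ : ∀ {c i} → IndexFrom a i → i ≤ ℓ → replicate c σ ⊑ drop a S → i + c ≤ ℓ
  replicate⊑drop⇒≤ {a} {c} from i≤ℓ s =
    replicate⊑slice⇒≤ {b = length S} from (λ _ k<ℓ _ → k<ℓ) i≤ℓ
      (subst (λ T → replicate c σ ⊑ drop a T) (sym (take-all (length S) S ≤-refl)) s)

  replicate⊑commonSubseq⇒bounds : ∀ {c k} {D : List A} → replicate c σ ⊑ D → k < ℓ →
    CommonSubseq D (slice S (p 0) (p k)) (drop (p k) S) → c ≤ k × k + c ≤ ℓ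
  replicate⊑commonSubseq⇒bounds σᶜ⊑D k<ℓ (D⊑prefix , D⊑suffix) =
    replicate⊑slice⇒≤ {a = p 0} (λ _ _ _ → z≤n) (indexBelow-p k<ℓ) z≤n (⊆-trans σᶜ⊑D D⊑prefix) ,
    replicate⊑drop⇒≤ (indexFrom-p k<ℓ) (<⇒≤ k<ℓ) (⊆-trans σᶜ⊑D D⊑suffix)

  -- The first copy of σV starts at some i_{k₀+1} ≥ i₁ and ends before the second copy,
  -- which starts at i_{k+1}.
  square-pivot : (B V : List A) → (B ++ σ ∷ V) ++ (B ++ σ ∷ V) ⊑ S →
    ∃[ k ] (k < ℓ × CommonSubseq (σ ∷ V) (slice S (p 0) (p k)) (drop (p k) S))
  square-pivot B V XX⊑S
    with ⊑drop-pivot 0 S B (subst (_⊑ S) (++-assoc B (σ ∷ V) (B ++ σ ∷ V)) XX⊑S)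
  ... | q₀ , _ , look₀ , _ , VX⊑ with σ-index look₀
  ... | k₀ , k₀<ℓ , refl
    with ⊑drop-pivot (suc (p k₀)) S (V ++ B)
           (subst (_⊑ drop (suc (p k₀)) S) (sym (++-assoc V B (σ ∷ V))) VX⊑)
  ... | q , pk₀<q , look , VB⊑ , V⊑ with σ-index look
  ... | k , k<ℓ , refl = k , k<ℓ , first-copy , !⇒∷⊑drop S (p k) look V⊑
    where
    first-copy : σ ∷ V ⊑ slice S (p 0) (p k)
    first-copy =
      ⊆-trans (!⇒∷⊑drop (take (p k) S) (p k₀) (trans (take-! S (p k₀) pk₀<q) look₀)
                         (⊆-trans (++⁺ʳ B ⊆-refl) VB⊑))
              (drop⁺-≥ (p-mono-≤ z≤n k₀<ℓ))

  rightExtendable⇒commonSubseq : (B R : List A) → RightExtendable (B ++ σ ∷ R) S →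
    ∃[ y ] ∃[ k ] (k < ℓ × CommonSubseq (σ ∷ R ++ [ y ]) (slice S (p 0) (p k)) (drop (p k) S))
  rightExtendable⇒commonSubseq B R (y , ext) =
    y , square-pivot B (R ++ [ y ]) (subst (λ X → X ++ X ⊑ S) (++-assoc B (σ ∷ R) [ y ]) ext)

module ChosenY {A : Set} (S : List A) (σ : A) (ℓ : ℕ) (p : ℕ → ℕ)
               (O : OccurrencePositions S σ ℓ p)
               (e : ℕ) (1≤e : 1 ≤ e) (half : Halving e ℓ) (Y₀ Y : List A)
               (maxY₀ : MaximalCS Y₀ (slice S (p 0) (p e)) (drop (p e) S))
               (σᵉ⊑Y₀ : replicate e σ ⊑ Y₀)
               (final : FinalY S ℓ p e Y₀ Y) where

  open Occurrences S σ ℓ p O public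

  private
    e<ℓ : e < ℓ
    e<ℓ = halving-< 1≤e half

  Y₀⊑Y : Y₀ ⊑ Y
  Y₀⊑Y = case final of λ where
    (inj₁ (_ , _ , Y₀⊑Y)) → Y₀⊑Y
    (inj₂ (_ , refl))     → ⊆-refl

  σᵉ⊑Y : replicate e σ ⊑ Y
  σᵉ⊑Y = ⊆-trans σᵉ⊑Y₀ Y₀⊑Y

  Y₀-head : ∃[ Y' ] Y₀ ≡ σ ∷ Y'
  Y₀-head = ⊑drop⇒head (take (p e) S) (p 0) σ-at-i₁ (proj₁ (proj₁ maxY₀)) Y₀⋢
    where
    σ-at-i₁ : take (p e) S ! p 0 ≡ just σ
    σ-at-i₁ = trans (take-! S (p 0) (p-mono-< 1≤e e<ℓ)) (p-σ (<-trans 1≤e e<ℓ))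
    Y₀⋢ : ¬ Y₀ ⊑ drop (suc (p 0)) (take (p e) S)
    Y₀⋢ s = 1+n≰n (replicate⊑slice⇒≤ (indexFrom-suc-p (<-trans 1≤e e<ℓ)) (indexBelow-p e<ℓ) 1≤e
                                     (⊆-trans σᵉ⊑Y₀ s))

  replaced-head : ℓ % 2 ≡ 1 → Y ⊑ drop (p (suc e)) S → ∃[ Y' ] Y ≡ σ ∷ Y'
  replaced-head ℓ%2≡1 Y⊑suffix = ⊑drop⇒head S (p (suc e)) (p-σ e+1<ℓ) Y⊑suffix Y⋢
    where
    ℓ≡ : ℓ ≡ suc (e + e)
    ℓ≡ = halving-odd half ℓ%2≡1
    e+1<ℓ : suc e < ℓ
    e+1<ℓ = subst (suc e <_) (sym ℓ≡) (s≤s (m<m+n e 1≤e))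
    Y⋢ : ¬ Y ⊑ drop (suc (p (suc e))) S
    Y⋢ s = 1+n≰n (subst (suc (suc e) + e ≤_) ℓ≡
                    (replicate⊑drop⇒≤ (indexFrom-suc-p e+1<ℓ) e+1<ℓ (⊆-trans σᵉ⊑Y s)))

  Y-head : ∃[ Y' ] Y ≡ σ ∷ Y'
  Y-head = case final of λ where
    (inj₁ ((ℓ%2≡1 , _) , ((_ , Y⊑suffix) , _) , _)) → replaced-head ℓ%2≡1 Y⊑suffix
    (inj₂ (_ , refl))                               → Y₀-head

  σ-decomposition : (W : List A) → Y ⊑ W → ∃[ B ] ∃[ R ] (W ≡ B ++ σ ∷ R × Y ⊑ σ ∷ R)
  σ-decomposition W Y⊑W with Y-head
  ... | Y' , refl with ∷⊑⇒++∷ Y⊑W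
  ... | B , R , W≡ , Y'⊑R = B , R , W≡ , refl ∷ Y'⊑R

  ¬commonSubseq-extension : ∀ {k} → Y ⊑ Z → k < ℓ →
    ¬ CommonSubseq (Z ++ [ y ]) (slice S (p 0) (p k)) (drop (p k) S)
  ¬commonSubseq-extension {Z = Z} {y = y} Y⊑Z k<ℓ common
    with replicate⊑commonSubseq⇒bounds (⊆-trans σᵉ⊑Y (⊆-trans Y⊑Z (++⁺ʳ [ y ] ⊆-refl))) k<ℓ common
  ... | e≤k , k+e≤ℓ with halving-window half e≤k k+e≤ℓ
  ... | inj₁ refl           = maximal⇒¬commonSubseq-∷ʳ maxY₀ (⊆-trans Y₀⊑Y Y⊑Z) common
  ... | inj₂ (ℓ%2≡1 , refl) = case final of λ where
      (inj₁ (_ , maxY , _))   → maximal⇒¬commonSubseq-∷ʳ maxY Y⊑Z common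
      (inj₂ (unreplaced , _)) → unreplaced (ℓ%2≡1 , ⊆-trans Y₀⊑Y (⊆-trans Y⊑Z Z⊑suffix))
    where
    Z⊑suffix : Z ⊑ drop (p (suc e)) S
    Z⊑suffix = ⊆-trans (++⁺ʳ [ y ] ⊆-refl) (proj₂ common)

lemma3 : {A : Set} (S : List A) (σ : A) (ℓ : ℕ) (p : ℕ → ℕ) →
    EveryCharTwice S →
    2 ≤ ℓ →
    OccurrencePositions S σ ℓ p →
    (Y₀ Y : List A) →
    MaximalCS Y₀ (slice S (p 0) (p ⌊ ℓ /2⌋)) (drop (p ⌊ ℓ /2⌋) S) →
    replicate ⌊ ℓ /2⌋ σ ⊑ Y₀ →
    FinalY S ℓ p ⌊ ℓ /2⌋ Y₀ Y →
    (W : List A) → SquareSubseq W S → (Y ++ Y) ⊑ (W ++ W) →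
    ¬ RightExtendable W S
lemma3 S σ ℓ p _ 2≤ℓ O Y₀ Y maxY₀ σᵉ⊑Y₀ final W _ YY⊑WW ext =
  let open ChosenY S σ ℓ p O ⌊ ℓ /2⌋ (⌊n/2⌋-mono 2≤ℓ) (⌊n/2⌋-halving ℓ) Y₀ Y maxY₀ σᵉ⊑Y₀ final
      (B , R , W≡BσR , Y⊑σR) = σ-decomposition W (square⊑square⇒⊑ YY⊑WW)
      (y , k , k<ℓ , common) = rightExtendable⇒commonSubseq B R
                                 (subst (λ V → RightExtendable V S) W≡BσR ext)
  in ¬commonSubseq-extension Y⊑σR k<ℓ common
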